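{- Let $G$ be a graph on $k$ vertices and let $n\ge k$ be an integer. Every $n$-blow-up colouring $R\cup B\cup P$ of $G$ satisfies: (1) $\omega(R\cup P)=\omega(G)$; (2) $\alpha(R)=\omega(B\cup P)\le\lceil n/k\rceil\,\alpha(G)$; (3) $\big||P|-e(G)\,n^2/k^2\big|\le e(G)\,3n/k$; (4) $|R|\le e(G)\,(n/k+1)$.
   Context: Let $G$ have vertices $v_1,\dots,v_k$ and $n\ge k$. An $n$-blow-up colouring of $G$ is a red/blue/purple colouring (partition $R\cup B\cup P$ of the edges) of $K_n$ defined as follows. Let $H$ be an equitable blow-up of $G$: each $v_i$ is replaced by a set $V_i$ of size $\lfloor n/k\rfloor$ or $\lceil n/k\rceil$ with $\sum_i|V_i|=n$, and each edge $v_iv_j$ of $G$ by a complete bipartite graph between $V_i$ and $V_j$. Write $V_i=\{u^i_1,\dots,u^i_{|V_i|}\}$. For every edge $v_iv_j$ of $G$ and every $\ell$, the edge $u^i_\ell u^j_\ell$ of $H$ (if it exists) is coloured red; all other edges of $H$ are coloured purple; all edges of $K_n$ not in $H$ are coloured blue. $R,B,P$ are the sets of red, blue, purple edges; $\omega$ and $\alpha$ denote clique and independence numbers of the corresponding spanning graphs. -}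

module Defs where

open import Data.Nat using (ℕ; zero; suc; _+_; _*_; _∸_; _≤_; _<_; _<ᵇ_; _≡ᵇ_; NonZero; _/_)
open import Data.Bool using (Bool; true; false; if_then_else_; _∧_)
open import Data.Fin using (Fin; toℕ)
open import Data.Fin.Subset using (Subset; _∈_; ∣_∣)
open import Data.List using (List; map; allFin)
open import Data.Nat.ListAction using (sum)
open import Data.Product using (_×_; ∃)
open import Data.Sum using (_⊎_)
open import Relation.Binary.PropositionalEquality using (_≡_; _≢_)
open import Relation.Nullary using (¬_)

record Graph (k : ℕ) : Set where
  field
    adj    : Fin k → Fin k → Bool
    sym    : ∀ i j → adj i j ≡ adj j i
    irrefl : ∀ i → adj i i ≡ false
open Graph public

⌈_/_⌉ : ℕ → (k : ℕ) → .{{NonZero k}} → ℕ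
⌈ n / k ⌉ = (n + (k ∸ 1)) / k

sumFin : (k : ℕ) → (Fin k → ℕ) → ℕ
sumFin k f = sum (map f (allFin k))

countPairs : (m : ℕ) → (Fin m → Fin m → Bool) → ℕ
countPairs m p = sumFin m (λ x → sumFin m (λ y →
  if (toℕ x <ᵇ toℕ y) ∧ p x y then 1 else 0))

edges : {k : ℕ} → Graph k → ℕ
edges {k} G = countPairs k (adj G)

IsClique : {m : ℕ} → (Fin m → Fin m → Set) → Subset m → Set
IsClique E S = ∀ x y → x ∈ S → y ∈ S → x ≢ y → E x y

IsIndependent : {m : ℕ} → (Fin m → Fin m → Set) → Subset m → Set
IsIndependent E S = ∀ x y → x ∈ S → y ∈ S → x ≢ y → ¬ E x y

IsCliqueNumber : {m : ℕ} → (Fin m → Fin m → Set) → ℕ → Set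
IsCliqueNumber E w =
  (∃ λ S → IsClique E S × ∣ S ∣ ≡ w) × (∀ S → IsClique E S → ∣ S ∣ ≤ w)

IsIndepNumber : {m : ℕ} → (Fin m → Fin m → Set) → ℕ → Set
IsIndepNumber E a =
  (∃ λ S → IsIndependent E S × ∣ S ∣ ≡ a) × (∀ S → IsIndependent E S → ∣ S ∣ ≤ a)

GEdge : {k : ℕ} → Graph k → Fin k → Fin k → Set
GEdge G i j = adj G i j ≡ true

-- An equitable blow-up of G on the vertex set Fin n of K_n:
-- vertex x lies in class V_(cls x) and is the vertex u^(cls x)_(pos x)
-- (positions counted from 0).  (cls , pos) is injective and
-- pos x < |V_(cls x)|; together with Σ |V_i| = n this makes
-- x ↦ (cls x , pos x) a bijection onto the disjoint union of the classes.
record BlowUp {k : ℕ} .{{_ : NonZero k}} (G : Graph k) (n : ℕ) : Set where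
  field
    size      : Fin k → ℕ
    size-sum  : sumFin k size ≡ n
    equitable : ∀ i → size i ≡ n / k ⊎ size i ≡ ⌈ n / k ⌉
    cls       : Fin n → Fin k
    pos       : Fin n → ℕ
    pos<      : ∀ x → pos x < size (cls x)
    injective : ∀ x y → cls x ≡ cls y → pos x ≡ pos y → x ≡ y
open BlowUp public

data Colour : Set where
  red blue purple : Colour

isRed isBlue isPurple : Colour → Bool
isRed red = true
isRed _ = false
isBlue blue = true
isBlue _ = false
isPurple purple = true
isPurple _ = false

colour : {k n : ℕ} .{{_ : NonZero k}} {G : Graph k} → BlowUp G n → Fin n → Fin n → Colour
colour {G = G} b x y =
  if adj G (cls b x) (cls b y)
  then (if pos b x ≡ᵇ pos b y then red else purple)
  else blue

RedE : {k n : ℕ} .{{_ : NonZero k}} {G : Graph k} → BlowUp G n → Fin n → Fin n → Set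
RedE b x y = colour b x y ≡ red

RedPurpleE : {k n : ℕ} .{{_ : NonZero k}} {G : Graph k} → BlowUp G n → Fin n → Fin n → Set
RedPurpleE b x y = colour b x y ≡ red ⊎ colour b x y ≡ purple

BluePurpleE : {k n : ℕ} .{{_ : NonZero k}} {G : Graph k} → BlowUp G n → Fin n → Fin n → Set
BluePurpleE b x y = colour b x y ≡ blue ⊎ colour b x y ≡ purple

numRed numPurple : {k n : ℕ} .{{_ : NonZero k}} {G : Graph k} → BlowUp G n → ℕ
numRed {n = n} b = countPairs n (λ x y → isRed (colour b x y))
numPurple {n = n} b = countPairs n (λ x y → isPurple (colour b x y))

{-# OPTIONS --safe #-}
module Submission where

open import Defs renaming (sym to adj-sym; irrefl to adj-irrefl)
open import Data.Nat.Properties hiding (_≟_; suc-injective)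
open import Algebra.Properties.CommutativeMonoid.Sum +-0-commutativeMonoid
  using (sum-syntax; ∑-comm; ∑-distrib-+; sum-cong-≗; sum-replicate-zero)
open import Algebra.Properties.Semiring.Sum +-*-semiring using (*-distribˡ-sum)
open import Algebra.Properties.CommutativeSemigroup *-commutativeSemigroup using (x∙yz≈y∙xz)
open import Data.Bool using (Bool; true; false; T; if_then_else_; _∧_; not)
open import Data.Bool.Properties using (T-∧; T-≡)
open import Data.Fin using (Fin; zero; suc; toℕ; fromℕ<)
open import Data.Fin.Properties using (_≟_; toℕ-injective; toℕ-fromℕ<; suc-injective)
open import Data.Fin.Subset using (Subset; _∈_; ∣_∣)
open import Data.Fin.Subset.Properties using (nonempty?; Empty-unique; ∣⊥∣≡0)
open import Data.List using (tabulate)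
open import Data.List.Properties using (map-tabulate)
import Data.Nat.ListAction as List
open import Data.Nat using (ℕ; zero; suc; _+_; _*_; _≤_; _<_; _<ᵇ_; _≡ᵇ_; z≤n; s≤s; _/_; _%_; pred)
open import Data.Nat.DivMod using (m/n*n≤m; m≡m%n+[m/n]*n; m%n<n; n/n≡1; /-monoˡ-≤)
open import Data.Nat.Tactic.RingSolver using (solve-∀)
open import Data.Product using (_×_; ∃; _,_; proj₁; proj₂)
open import Data.Sum using (_⊎_; inj₁; inj₂)
open import Data.Unit using (tt)
open import Data.Vec using ([]; _∷_; lookup)
import Data.Vec as Vec
open import Data.Vec.Properties using (lookup∘tabulate; []=⇒lookup; lookup⇒[]=)
open import Function using (_∘_; Equivalence)
open import Relation.Binary.PropositionalEquality
open import Relation.Nullary using (Dec; ¬_; yes; no; does; contradiction)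

-- x ↦ (cls x , pos x) is injective, and since the class sizes add up to n it is onto
-- the pairs (i , ℓ) with ℓ < |V_i|.  So sums over the vertices of K_n re-index as sums
-- over classes and positions, and the colour of xy depends only on those of x and y.
-- (1) Classes contain no red or purple edge, so a red/purple clique meets every class at
-- most once and cls maps it injectively onto a clique of G; conversely the vertices in
-- position 0 over a clique of G form a red clique.
-- (2) Red is the complement of blue ∪ purple.  A red-independent set meets each row
-- {pos = ℓ}, ℓ < ⌈n/k⌉, in a set that cls maps injectively onto an independent set of G.
-- (3), (4) An edge ij of G carries min(|V_i|, |V_j|) red edges and all other edges
-- between V_i and V_j are purple; ⌊n/k⌋ ≤ |V_i| ≤ ⌈n/k⌉ bounds both counts edge by edge,
-- and the estimates follow by summing over the edges of G.

-- Finite sums and indicators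

𝟙 : Bool → ℕ
𝟙 b = if b then 1 else 0

𝟙-∧ : ∀ a b → 𝟙 (a ∧ b) ≡ 𝟙 a * 𝟙 b
𝟙-∧ true  b = sym (+-identityʳ (𝟙 b))
𝟙-∧ false b = refl

𝟙*-mono-≤ : ∀ b {x y} → (T b → x ≤ y) → 𝟙 b * x ≤ 𝟙 b * y
𝟙*-mono-≤ true  x≤y = *-monoʳ-≤ 1 (x≤y tt)
𝟙*-mono-≤ false _   = z≤n

𝟙-not : ∀ b → 𝟙 (not b) + 𝟙 b ≡ 1
𝟙-not true  = refl
𝟙-not false = refl

≡ᵇ-sym : ∀ m n → (m ≡ᵇ n) ≡ (n ≡ᵇ m)
≡ᵇ-sym zero    zero    = refl
≡ᵇ-sym zero    (suc n) = refl
≡ᵇ-sym (suc m) zero    = refl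
≡ᵇ-sym (suc m) (suc n) = ≡ᵇ-sym m n

T-does⇒ : ∀ {P : Set} (d : Dec P) → T (does d) → P
T-does⇒ (yes p) _ = p

∑-mono-≤ : ∀ {m} {f g : Fin m → ℕ} → (∀ i → f i ≤ g i) → ∑[ i < m ] f i ≤ ∑[ i < m ] g i
∑-mono-≤ {zero}  f≤g = z≤n
∑-mono-≤ {suc m} f≤g = +-mono-≤ (f≤g zero) (∑-mono-≤ (f≤g ∘ suc))

∑-const : ∀ m c → ∑[ i < m ] c ≡ m * c
∑-const zero    c = refl
∑-const (suc m) c = cong (c +_) (∑-const m c)

∑-zero : ∀ {m} {f : Fin m → ℕ} → (∀ i → f i ≡ 0) → ∑[ i < m ] f i ≡ 0
∑-zero {m} f≡0 = trans (sum-cong-≗ f≡0) (sum-replicate-zero m)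

+-≡⇒≡ˡ : ∀ {a b c d} → a ≤ c → b ≤ d → a + b ≡ c + d → a ≡ c
+-≡⇒≡ˡ {a} {b} {c} {d} a≤c b≤d eq = ≤-antisym a≤c (+-cancelʳ-≤ b c a (begin
  c + b ≤⟨ +-monoʳ-≤ c b≤d ⟩
  c + d ≡⟨ sym eq ⟩
  a + b ∎))
  where open ≤-Reasoning

∑-≤-≡⇒≡ : ∀ {m} {f g : Fin m → ℕ} → (∀ i → f i ≤ g i) →
  ∑[ i < m ] f i ≡ ∑[ i < m ] g i → ∀ i → f i ≡ g i
∑-≤-≡⇒≡ {suc m} {f} {g} f≤g eq = λ where
    zero    → f₀≡g₀
    (suc i) → ∑-≤-≡⇒≡ (f≤g ∘ suc) (+-cancelˡ-≡ (g zero) _ _ (subst (λ t → t + _ ≡ _) f₀≡g₀ eq)) i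
  where
  f₀≡g₀ : f zero ≡ g zero
  f₀≡g₀ = +-≡⇒≡ˡ (f≤g zero) (∑-mono-≤ (f≤g ∘ suc)) eq

∑-select : ∀ {m} (x : Fin m) (g : Fin m → ℕ) → ∑[ i < m ] (𝟙 (does (x ≟ i)) * g i) ≡ g x
∑-select {suc m} zero    g =
  trans (cong₂ _+_ (+-identityʳ (g zero)) (sum-replicate-zero m)) (+-identityʳ (g zero))
∑-select {suc m} (suc x) g = ∑-select x (g ∘ suc)

∑-selectℕ : ∀ {s p} → p < s → (g : ℕ → ℕ) →
  ∑[ ℓ < s ] (𝟙 (p ≡ᵇ toℕ ℓ) * g (toℕ ℓ)) ≡ g p
∑-selectℕ {suc s} {zero}  _         g =
  trans (cong₂ _+_ (+-identityʳ (g 0)) (sum-replicate-zero s)) (+-identityʳ (g 0))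
∑-selectℕ {suc s} {suc p} (s≤s p<s) g = ∑-selectℕ p<s (g ∘ suc)

∑-𝟙-≤1 : ∀ {m} (P : Fin m → Bool) → (∀ x y → T (P x) → T (P y) → x ≡ y) →
  ∑[ x < m ] 𝟙 (P x) ≤ 1
∑-𝟙-≤1 {zero}  P unique = z≤n
∑-𝟙-≤1 {suc m} P unique with P zero in P₀
... | true  = ≤-reflexive (cong suc (∑-zero rest-false))
  where
  rest-false : ∀ x → 𝟙 (P (suc x)) ≡ 0
  rest-false x with P (suc x) in Pₓ
  ... | false = refl
  ... | true  with unique zero (suc x) (subst T (sym P₀) tt) (subst T (sym Pₓ) tt)
  ...   | ()
... | false = ∑-𝟙-≤1 (P ∘ suc) (λ x y Px Py → suc-injective (unique (suc x) (suc y) Px Py))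

sumFin≡∑ : ∀ m (f : Fin m → ℕ) → sumFin m f ≡ ∑[ i < m ] f i
sumFin≡∑ m f = trans (cong List.sum (map-tabulate (λ i → i) f)) (sum-tabulate m f)
  where
  sum-tabulate : ∀ m (f : Fin m → ℕ) → List.sum (tabulate f) ≡ ∑[ i < m ] f i
  sum-tabulate zero    f = refl
  sum-tabulate (suc m) f = cong (f zero +_) (sum-tabulate m (f ∘ suc))

-- Fibres and images of subsets

∣p∣≡∑ : ∀ {m} (p : Subset m) → ∣ p ∣ ≡ ∑[ x < m ] 𝟙 (lookup p x)
∣p∣≡∑ []          = refl
∣p∣≡∑ (true ∷ p)  = cong suc (∣p∣≡∑ p)
∣p∣≡∑ (false ∷ p) = ∣p∣≡∑ p

module _ {m : ℕ} where

  ∣tabulate∣ : (P : Fin m → Bool) → ∣ Vec.tabulate P ∣ ≡ ∑[ x < m ] 𝟙 (P x)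
  ∣tabulate∣ P = trans (∣p∣≡∑ (Vec.tabulate P)) (sum-cong-≗ (cong 𝟙 ∘ lookup∘tabulate P))

  ∈⇒T : ∀ {x} {p : Subset m} → x ∈ p → T (lookup p x)
  ∈⇒T x∈p = subst T (sym ([]=⇒lookup x∈p)) tt

  T⇒∈ : ∀ {x} {p : Subset m} → T (lookup p x) → x ∈ p
  T⇒∈ {x} {p} t = lookup⇒[]= x p (Equivalence.to T-≡ t)

  ∈-tabulate⁻ : ∀ {x} {P : Fin m → Bool} → x ∈ Vec.tabulate P → T (P x)
  ∈-tabulate⁻ {x} {P} x∈ = subst T (lookup∘tabulate P x) (∈⇒T x∈)

  ∣p∣≤1 : {p : Subset m} → (∀ {x y} → x ∈ p → y ∈ p → x ≡ y) → ∣ p ∣ ≤ 1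
  ∣p∣≤1 {p} unique = ≤-trans (≤-reflexive (∣p∣≡∑ p))
    (∑-𝟙-≤1 (lookup p) (λ x y px py → unique (T⇒∈ px) (T⇒∈ py)))

InjectiveOn : ∀ {a} {B : Set} → (Fin a → B) → Subset a → Set
InjectiveOn f p = ∀ {x y} → x ∈ p → y ∈ p → f x ≡ f y → x ≡ y

module _ {a c : ℕ} (f : Fin a → Fin c) where

  fibre : Subset a → Fin c → Subset a
  fibre p i = Vec.tabulate (λ x → does (f x ≟ i) ∧ lookup p x)

  image : Subset a → Subset c
  image p = Vec.tabulate (λ i → does (nonempty? (fibre p i)))

  ∈-fibre⁻ : ∀ {p i x} → x ∈ fibre p i → f x ≡ i × x ∈ p
  ∈-fibre⁻ x∈ with Equivalence.to T-∧ (∈-tabulate⁻ x∈)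
  ... | fx≡i , x∈p = T-does⇒ (f _ ≟ _) fx≡i , T⇒∈ x∈p

  ∈-image⁻ : ∀ {p i} → i ∈ image p → ∃ λ x → x ∈ p × f x ≡ i
  ∈-image⁻ i∈ with T-does⇒ (nonempty? _) (∈-tabulate⁻ i∈)
  ... | x , x∈fibre with ∈-fibre⁻ x∈fibre
  ...   | fx≡i , x∈p = x , x∈p , fx≡i

  ∣p∣≡∑∣fibre∣ : (p : Subset a) → ∣ p ∣ ≡ ∑[ i < c ] ∣ fibre p i ∣
  ∣p∣≡∑∣fibre∣ p = begin
    ∣ p ∣
      ≡⟨ ∣p∣≡∑ p ⟩
    ∑[ x < a ] 𝟙 (lookup p x)
      ≡⟨ sum-cong-≗ (λ x → ∑-select (f x) (λ _ → 𝟙 (lookup p x))) ⟨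
    ∑[ x < a ] ∑[ i < c ] (𝟙 (does (f x ≟ i)) * 𝟙 (lookup p x))
      ≡⟨ ∑-comm (λ x i → 𝟙 (does (f x ≟ i)) * 𝟙 (lookup p x)) ⟩
    ∑[ i < c ] ∑[ x < a ] (𝟙 (does (f x ≟ i)) * 𝟙 (lookup p x))
      ≡⟨ sum-cong-≗ ∣fibre∣ ⟨
    ∑[ i < c ] ∣ fibre p i ∣ ∎
    where
    open ≡-Reasoning
    ∣fibre∣ : ∀ i → ∣ fibre p i ∣ ≡ ∑[ x < a ] (𝟙 (does (f x ≟ i)) * 𝟙 (lookup p x))
    ∣fibre∣ i = trans (∣tabulate∣ (λ x → does (f x ≟ i) ∧ lookup p x))
                      (sum-cong-≗ (λ x → 𝟙-∧ (does (f x ≟ i)) (lookup p x)))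

  ∣p∣≤∣image∣ : ∀ {p} → InjectiveOn f p → ∣ p ∣ ≤ ∣ image p ∣
  ∣p∣≤∣image∣ {p} inj = begin
    ∣ p ∣
      ≡⟨ ∣p∣≡∑∣fibre∣ p ⟩
    ∑[ i < c ] ∣ fibre p i ∣
      ≤⟨ ∑-mono-≤ ∣fibre∣≤ ⟩
    ∑[ i < c ] 𝟙 (does (nonempty? (fibre p i)))
      ≡⟨ ∣tabulate∣ (λ i → does (nonempty? (fibre p i))) ⟨
    ∣ image p ∣ ∎
    where
    open ≤-Reasoning
    ∣fibre∣≤ : ∀ i → ∣ fibre p i ∣ ≤ 𝟙 (does (nonempty? (fibre p i)))
    ∣fibre∣≤ i with nonempty? (fibre p i)
    ... | yes _     = ∣p∣≤1 λ x∈ y∈ →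
      let (fx≡i , x∈p) = ∈-fibre⁻ x∈; (fy≡i , y∈p) = ∈-fibre⁻ y∈
      in inj x∈p y∈p (trans fx≡i (sym fy≡i))
    ... | no  empty = ≤-reflexive (trans (cong ∣_∣ (Empty-unique empty)) (∣⊥∣≡0 a))

module _ {a c : ℕ} {E : Fin a → Fin a → Set} {E′ : Fin c → Fin c → Set} (f : Fin a → Fin c) where

  image-isClique : (∀ {x y} → E x y → E′ (f x) (f y)) →
    ∀ {S} → IsClique E S → IsClique E′ (image f S)
  image-isClique hom clq i j i∈ j∈ i≢j with ∈-image⁻ f i∈ | ∈-image⁻ f j∈
  ... | x , x∈S , refl | y , y∈S , refl = hom (clq x y x∈S y∈S (i≢j ∘ cong f))

  image-isIndependent : ∀ {S} → (∀ {x y} → x ∈ S → y ∈ S → E′ (f x) (f y) → E x y) →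
    IsIndependent E S → IsIndependent E′ (image f S)
  image-isIndependent reflects ind i j i∈ j∈ i≢j with ∈-image⁻ f i∈ | ∈-image⁻ f j∈
  ... | x , x∈S , refl | y , y∈S , refl = ind x y x∈S y∈S (i≢j ∘ cong f) ∘ reflects x∈S y∈S

  homomorphism⇒clique≤ : (∀ {x y} → E x y → E′ (f x) (f y)) → (∀ i → ¬ E′ i i) →
    ∀ {w} → (∀ T → IsClique E′ T → ∣ T ∣ ≤ w) → ∀ S → IsClique E S → ∣ S ∣ ≤ w
  homomorphism⇒clique≤ hom loopless bound S clq =
    ≤-trans (∣p∣≤∣image∣ f f-injective) (bound _ (image-isClique hom clq))
    where
    f-injective : InjectiveOn f S
    f-injective {x} {y} x∈S y∈S fx≡fy with x ≟ y
    ... | yes x≡y = x≡y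
    ... | no  x≢y =
      contradiction (subst (E′ (f x)) (sym fx≡fy) (hom (clq x y x∈S y∈S x≢y))) (loopless (f x))

  reflecting⇒independent≤ : ∀ {S} → InjectiveOn f S →
    (∀ {x y} → x ∈ S → y ∈ S → E′ (f x) (f y) → E x y) → IsIndependent E S →
    ∀ {g} → (∀ T → IsIndependent E′ T → ∣ T ∣ ≤ g) → ∣ S ∣ ≤ g
  reflecting⇒independent≤ inj reflects ind bound =
    ≤-trans (∣p∣≤∣image∣ f inj) (bound _ (image-isIndependent reflects ind))

indepNumber≡cliqueNumber : ∀ {m} {E E′ : Fin m → Fin m → Set} →
  (∀ {x y} → ¬ E x y → E′ x y) → (∀ {x y} → E′ x y → ¬ E x y) →
  ∀ {a c} → IsIndepNumber E a → IsCliqueNumber E′ c → a ≡ c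
indepNumber≡cliqueNumber to from ((S , ind , ∣S∣≡a) , maxIndep) ((S′ , clq , ∣S′∣≡c) , maxClique) =
  ≤-antisym (subst (_≤ _) ∣S∣≡a  (maxClique S (λ x y x∈ y∈ x≢y → to (ind x y x∈ y∈ x≢y))))
            (subst (_≤ _) ∣S′∣≡c (maxIndep S′ (λ x y x∈ y∈ x≢y → from (clq x y x∈ y∈ x≢y))))

-- Counting edges

module _ {m : ℕ} (p : Fin m → Fin m → Bool)
         (p-sym : ∀ x y → p x y ≡ p y x) (p-irrefl : ∀ x → p x x ≡ false) where

  private
    ordered : Fin m → Fin m → ℕ
    ordered x y = 𝟙 ((toℕ x <ᵇ toℕ y) ∧ p x y)

    ≮ : ∀ {i j} → (i <ᵇ j) ≡ false → ¬ i < j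
    ≮ i≮ᵇj i<j = subst T i≮ᵇj (<⇒<ᵇ i<j)

    ordered+ordered : ∀ x y → ordered x y + ordered y x ≡ 𝟙 (p x y)
    ordered+ordered x y with toℕ x <ᵇ toℕ y in x<y | toℕ y <ᵇ toℕ x in y<x
    ... | true  | true  = contradiction (<ᵇ⇒< (toℕ y) (toℕ x) (subst T (sym y<x) tt))
                                        (<-asym (<ᵇ⇒< (toℕ x) (toℕ y) (subst T (sym x<y) tt)))
    ... | true  | false = +-identityʳ _
    ... | false | true  = cong 𝟙 (p-sym y x)
    ... | false | false with toℕ-injective (≤-antisym (≮⇒≥ (≮ {toℕ y} y<x)) (≮⇒≥ (≮ {toℕ x} x<y)))
    ...   | refl = cong 𝟙 (sym (p-irrefl x))

  2*countPairs : 2 * countPairs m p ≡ ∑[ x < m ] ∑[ y < m ] 𝟙 (p x y)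
  2*countPairs = begin
    2 * countPairs m p
      ≡⟨ cong (2 *_) countPairs≡∑ ⟩
    2 * O
      ≡⟨ cong (O +_) (+-identityʳ O) ⟩
    O + O
      ≡⟨ cong (O +_) (∑-comm ordered) ⟩
    O + ∑[ x < m ] ∑[ y < m ] ordered y x
      ≡⟨ ∑-distrib-+ (λ x → ∑[ y < m ] ordered x y) (λ x → ∑[ y < m ] ordered y x) ⟨
    ∑[ x < m ] (∑[ y < m ] ordered x y + ∑[ y < m ] ordered y x)
      ≡⟨ sum-cong-≗ (λ x → ∑-distrib-+ (ordered x) (λ y → ordered y x)) ⟨
    ∑[ x < m ] ∑[ y < m ] (ordered x y + ordered y x)
      ≡⟨ sum-cong-≗ (λ x → sum-cong-≗ (ordered+ordered x)) ⟩
    ∑[ x < m ] ∑[ y < m ] 𝟙 (p x y) ∎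
    where
    open ≡-Reasoning
    O : ℕ
    O = ∑[ x < m ] ∑[ y < m ] ordered x y
    countPairs≡∑ : countPairs m p ≡ O
    countPairs≡∑ = trans (sumFin≡∑ m _) (sum-cong-≗ (λ x → sumFin≡∑ m (ordered x)))

module _ {m : ℕ} (A : Fin m → Fin m → Bool) where

  -- Each edge of a symmetric A is counted twice, as (i , j) and as (j , i).
  arcSum : (Fin m → Fin m → ℕ) → ℕ
  arcSum X = ∑[ i < m ] ∑[ j < m ] (𝟙 (A i j) * X i j)

  arcs : ℕ
  arcs = arcSum (λ _ _ → 1)

  arcSum-cong : ∀ {X Y} → (∀ i j → X i j ≡ Y i j) → arcSum X ≡ arcSum Y
  arcSum-cong X≡Y = sum-cong-≗ (λ i → sum-cong-≗ (λ j → cong (𝟙 (A i j) *_) (X≡Y i j)))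

  arcSum-mono : ∀ {X Y} → (∀ i j → T (A i j) → X i j ≤ Y i j) → arcSum X ≤ arcSum Y
  arcSum-mono X≤Y = ∑-mono-≤ (λ i → ∑-mono-≤ (λ j → 𝟙*-mono-≤ (A i j) (X≤Y i j)))

  arcSum-*ˡ : ∀ c X → arcSum (λ i j → c * X i j) ≡ c * arcSum X
  arcSum-*ˡ c X = begin
    arcSum (λ i j → c * X i j)
      ≡⟨ sum-cong-≗ (λ i → sum-cong-≗ (λ j → x∙yz≈y∙xz (𝟙 (A i j)) c (X i j))) ⟩
    ∑[ i < m ] ∑[ j < m ] (c * (𝟙 (A i j) * X i j))
      ≡⟨ sum-cong-≗ (λ i → *-distribˡ-sum c (λ j → 𝟙 (A i j) * X i j)) ⟨
    ∑[ i < m ] (c * ∑[ j < m ] (𝟙 (A i j) * X i j))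
      ≡⟨ *-distribˡ-sum c (λ i → ∑[ j < m ] (𝟙 (A i j) * X i j)) ⟨
    c * arcSum X ∎
    where open ≡-Reasoning

  arcSum-+ : ∀ X Y → arcSum (λ i j → X i j + Y i j) ≡ arcSum X + arcSum Y
  arcSum-+ X Y = begin
    arcSum (λ i j → X i j + Y i j)
      ≡⟨ sum-cong-≗ (λ i → sum-cong-≗ (λ j → *-distribˡ-+ (𝟙 (A i j)) (X i j) (Y i j))) ⟩
    ∑[ i < m ] ∑[ j < m ] (𝟙 (A i j) * X i j + 𝟙 (A i j) * Y i j)
      ≡⟨ sum-cong-≗ (λ i → ∑-distrib-+ (λ j → 𝟙 (A i j) * X i j) (λ j → 𝟙 (A i j) * Y i j)) ⟩
    ∑[ i < m ] (∑[ j < m ] (𝟙 (A i j) * X i j) + ∑[ j < m ] (𝟙 (A i j) * Y i j))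
      ≡⟨ ∑-distrib-+ (λ i → ∑[ j < m ] (𝟙 (A i j) * X i j)) _ ⟩
    arcSum X + arcSum Y ∎
    where open ≡-Reasoning

  arcSum-const : ∀ c → arcSum (λ _ _ → c) ≡ c * arcs
  arcSum-const c = trans (arcSum-cong (λ _ _ → sym (*-identityʳ c))) (arcSum-*ˡ c (λ _ _ → 1))

  module _ (X : Fin m → Fin m → ℕ) {W E : ℕ} (2W : 2 * W ≡ arcSum X) (2E : 2 * E ≡ arcs) where

    averaged-≤ : ∀ c {d} → (∀ i j → T (A i j) → c * X i j ≤ d) → c * W ≤ d * E
    averaged-≤ c {d} bound = *-cancelˡ-≤ 2 (begin
      2 * (c * W)                 ≡⟨ x∙yz≈y∙xz 2 c W ⟩
      c * (2 * W)                 ≡⟨ cong (c *_) 2W ⟩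
      c * arcSum X                ≡⟨ arcSum-*ˡ c X ⟨
      arcSum (λ i j → c * X i j)  ≤⟨ arcSum-mono bound ⟩
      arcSum (λ _ _ → d)          ≡⟨ arcSum-const d ⟩
      d * arcs                    ≡⟨ cong (d *_) 2E ⟨
      d * (2 * E)                 ≡⟨ x∙yz≈y∙xz d 2 E ⟩
      2 * (d * E)                 ∎)
      where open ≤-Reasoning

    averaged-≥ : ∀ c {d e} → (∀ i j → T (A i j) → d ≤ c * X i j + e) → d * E ≤ c * W + e * E
    averaged-≥ c {d} {e} bound = *-cancelˡ-≤ 2 (begin
      2 * (d * E)                         ≡⟨ x∙yz≈y∙xz 2 d E ⟩
      d * (2 * E)                         ≡⟨ cong (d *_) 2E ⟩
      d * arcs                            ≡⟨ arcSum-const d ⟨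
      arcSum (λ _ _ → d)                  ≤⟨ arcSum-mono bound ⟩
      arcSum (λ i j → c * X i j + e)      ≡⟨ arcSum-+ _ _ ⟩
      arcSum (λ i j → c * X i j) + arcSum (λ _ _ → e) ≡⟨ cong₂ _+_ (arcSum-*ˡ c X) (arcSum-const e) ⟩
      c * arcSum X + e * arcs             ≡⟨ cong₂ (λ u v → c * u + e * v) 2W 2E ⟨
      c * (2 * W) + e * (2 * E)           ≡⟨ cong₂ _+_ (x∙yz≈y∙xz c 2 W) (x∙yz≈y∙xz e 2 E) ⟩
      2 * (c * W) + 2 * (e * E)           ≡⟨ *-distribˡ-+ 2 (c * W) (e * E) ⟨
      2 * (c * W + e * E)                 ∎)
      where open ≤-Reasoning

-- Class sizes

module _ (k n : ℕ) where

  K*⌈n/K⌉≤n+k : suc k * ⌈ n / suc k ⌉ ≤ n + k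
  K*⌈n/K⌉≤n+k = ≤-trans (≤-reflexive (*-comm (suc k) _)) (m/n*n≤m (n + k) (suc k))

  K*[n/K]≤n : suc k * (n / suc k) ≤ n
  K*[n/K]≤n = ≤-trans (≤-reflexive (*-comm (suc k) _)) (m/n*n≤m n (suc k))

  n≤k+K*[n/K] : n ≤ k + suc k * (n / suc k)
  n≤k+K*[n/K] = begin
    n
      ≡⟨ m≡m%n+[m/n]*n n (suc k) ⟩
    n % suc k + n / suc k * suc k
      ≤⟨ +-mono-≤ (≤-pred (m%n<n n (suc k))) (≤-reflexive (*-comm (n / suc k) (suc k))) ⟩
    k + suc k * (n / suc k) ∎
    where open ≤-Reasoning

  n/K≤⌈n/K⌉ : n / suc k ≤ ⌈ n / suc k ⌉
  n/K≤⌈n/K⌉ = /-monoˡ-≤ (suc k) (m≤m+n n k)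

  K≤n⇒1≤n/K : suc k ≤ n → 1 ≤ n / suc k
  K≤n⇒1≤n/K K≤n = ≤-trans (≤-reflexive (sym (n/n≡1 (suc k)))) (/-monoˡ-≤ (suc k) K≤n)

module _ {k n : ℕ} where

  private
    K : ℕ
    K = suc k

  pairBound-upper : ∀ {a c q} → k ≤ n → K * a ≤ n + k → K * c ≤ n + k → q ≤ a * c →
    K * K * q ≤ n * n + 3 * n * K
  pairBound-upper {a} {c} {q} k≤n Ka≤n+k Kc≤n+k q≤ac = begin
    K * K * q                      ≤⟨ *-monoʳ-≤ (K * K) q≤ac ⟩
    K * K * (a * c)                ≡⟨ [m*n]*[o*p]≡[m*o]*[n*p] K K a c ⟩
    (K * a) * (K * c)              ≤⟨ *-mono-≤ Ka≤n+k Kc≤n+k ⟩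
    (n + k) * (n + k)              ≡⟨ expand n k ⟩
    n * n + (2 * n + k) * k        ≤⟨ +-monoʳ-≤ (n * n) (*-mono-≤ (+-monoʳ-≤ (2 * n) k≤n) (n≤1+n k)) ⟩
    n * n + (2 * n + n) * K        ≡⟨ cong (λ t → n * n + t * K) (+-comm (2 * n) n) ⟩
    n * n + 3 * n * K              ∎
    where
    open ≤-Reasoning
    expand : ∀ n k → (n + k) * (n + k) ≡ n * n + (2 * n + k) * k
    expand = solve-∀

  pairBound-lower : ∀ {f q} → 1 ≤ f → K * f ≤ n → n ≤ k + K * f → f * pred f ≤ q →
    n * n ≤ K * K * q + 3 * n * K
  pairBound-lower {suc u} {q} _ F≤n n≤k+F fu≤q = begin
    n * n
      ≤⟨ *-monoʳ-≤ n n≤K+F ⟩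
    n * (K + F)
      ≡⟨ *-distribˡ-+ n K F ⟩
    n * K + n * F
      ≤⟨ +-monoʳ-≤ (n * K) (*-monoˡ-≤ F n≤K+F) ⟩
    n * K + (K + F) * F
      ≡⟨ cong (n * K +_) (expand k u) ⟩
    n * K + (2 * (F * K) + K * K * (suc u * u))
      ≤⟨ +-monoʳ-≤ (n * K) (+-mono-≤ (*-monoʳ-≤ 2 (*-monoˡ-≤ K F≤n)) (*-monoʳ-≤ (K * K) fu≤q)) ⟩
    n * K + (2 * (n * K) + K * K * q)
      ≡⟨ collect n K (K * K * q) ⟩
    K * K * q + 3 * n * K ∎
    where
    open ≤-Reasoning
    F : ℕ
    F = K * suc u
    n≤K+F : n ≤ K + F
    n≤K+F = ≤-trans n≤k+F (+-monoˡ-≤ F (n≤1+n k))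
    expand : ∀ k u → (suc k + suc k * suc u) * (suc k * suc u)
                     ≡ 2 * (suc k * suc u * suc k) + suc k * suc k * (suc u * u)
    expand = solve-∀
    collect : ∀ n K y → n * K + (2 * (n * K) + y) ≡ y + 3 * n * K
    collect = solve-∀

-- Pairs of positions (ℓ , m) in two classes of sizes a and c with ℓ = m (the red edges
-- between them) and with ℓ ≢ m (the purple ones).
diagonal offDiagonal : ℕ → ℕ → ℕ
diagonal    a c = ∑[ ℓ < a ] ∑[ m < c ] 𝟙 (toℕ ℓ ≡ᵇ toℕ m)
offDiagonal a c = ∑[ ℓ < a ] ∑[ m < c ] 𝟙 (not (toℕ ℓ ≡ᵇ toℕ m))

diagonal≤ : ∀ a c → diagonal a c ≤ a
diagonal≤ a c = begin
  diagonal a c  ≤⟨ ∑-mono-≤ row≤1 ⟩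
  ∑[ ℓ < a ] 1  ≡⟨ ∑-const a 1 ⟩
  a * 1         ≡⟨ *-identityʳ a ⟩
  a             ∎
  where
  open ≤-Reasoning
  row≤1 : (ℓ : Fin a) → ∑[ m < c ] 𝟙 (toℕ ℓ ≡ᵇ toℕ m) ≤ 1
  row≤1 ℓ = ∑-𝟙-≤1 {c} (λ m → toℕ ℓ ≡ᵇ toℕ m) λ m m′ ℓ≡m ℓ≡m′ →
    toℕ-injective (trans (sym (≡ᵇ⇒≡ (toℕ ℓ) (toℕ m) ℓ≡m)) (≡ᵇ⇒≡ (toℕ ℓ) (toℕ m′) ℓ≡m′))

offDiagonal+diagonal : ∀ a c → offDiagonal a c + diagonal a c ≡ a * c
offDiagonal+diagonal a c = begin
  offDiagonal a c + diagonal a c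
    ≡⟨ ∑-distrib-+ (λ ℓ → ∑[ m < c ] 𝟙 (not (e ℓ m))) _ ⟨
  ∑[ ℓ < a ] (∑[ m < c ] 𝟙 (not (e ℓ m)) + ∑[ m < c ] 𝟙 (e ℓ m))
    ≡⟨ sum-cong-≗ (λ ℓ → ∑-distrib-+ (λ m → 𝟙 (not (e ℓ m))) _) ⟨
  ∑[ ℓ < a ] ∑[ m < c ] (𝟙 (not (e ℓ m)) + 𝟙 (e ℓ m))
    ≡⟨ sum-cong-≗ (λ ℓ → sum-cong-≗ (λ m → 𝟙-not (e ℓ m))) ⟩
  ∑[ ℓ < a ] ∑[ m < c ] 1
    ≡⟨ sum-cong-≗ {a} (λ _ → trans (∑-const c 1) (*-identityʳ c)) ⟩
  ∑[ ℓ < a ] c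
    ≡⟨ ∑-const a c ⟩
  a * c ∎
  where
  open ≡-Reasoning
  e : Fin a → Fin c → Bool
  e ℓ m = toℕ ℓ ≡ᵇ toℕ m

offDiagonal≤ : ∀ a c → offDiagonal a c ≤ a * c
offDiagonal≤ a c = ≤-trans (m≤m+n _ _) (≤-reflexive (offDiagonal+diagonal a c))

f*pred[f]≤offDiagonal : ∀ {f a c} → f ≤ a → f ≤ c → f * pred f ≤ offDiagonal a c
f*pred[f]≤offDiagonal {zero}                 _   _         = z≤n
f*pred[f]≤offDiagonal {suc u} {a} {suc c} f≤a (s≤s u≤c) = begin
  suc u * u                                  ≤⟨ *-mono-≤ f≤a u≤c ⟩
  a * c                                      ≤⟨ +-cancelʳ-≤ (diagonal a (suc c)) (a * c) _ ac+d≤o+d ⟩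
  offDiagonal a (suc c)                      ∎
  where
  open ≤-Reasoning
  ac+d≤o+d : a * c + diagonal a (suc c) ≤ offDiagonal a (suc c) + diagonal a (suc c)
  ac+d≤o+d = begin
    a * c + diagonal a (suc c)                 ≤⟨ +-monoʳ-≤ (a * c) (diagonal≤ a (suc c)) ⟩
    a * c + a                                  ≡⟨ trans (+-comm (a * c) a) (sym (*-suc a c)) ⟩
    a * suc c                                  ≡⟨ offDiagonal+diagonal a (suc c) ⟨
    offDiagonal a (suc c) + diagonal a (suc c) ∎

-- Injective labellings

module InjectiveLabelling {K n : ℕ} (s : Fin K → ℕ) (κ : Fin n → Fin K) (π : Fin n → ℕ)
                 (π< : ∀ x → π x < s (κ x))
                 (κπ-injective : ∀ x y → κ x ≡ κ y → π x ≡ π y → x ≡ y)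
                 (∑s≡n : ∑[ i < K ] s i ≡ n) where

  fibreSize : (i : Fin K) → Fin (s i) → ℕ
  fibreSize i ℓ = ∑[ x < n ] 𝟙 (does (κ x ≟ i) ∧ (π x ≡ᵇ toℕ ℓ))

  ∑-by-fibreSize : (h : Fin K → ℕ → ℕ) →
    ∑[ x < n ] h (κ x) (π x) ≡ ∑[ i < K ] ∑[ ℓ < s i ] (h i (toℕ ℓ) * fibreSize i ℓ)
  ∑-by-fibreSize h = begin
    ∑[ x < n ] h (κ x) (π x)
      ≡⟨ sum-cong-≗ (λ x → trans (∑-select (κ x) (λ i → ∑[ ℓ < s i ] (δπ x ℓ * h i (toℕ ℓ))))
                                 (∑-selectℕ (π< x) (h (κ x)))) ⟨
    ∑[ x < n ] ∑[ i < K ] (δκ x i * ∑[ ℓ < s i ] (δπ x ℓ * h i (toℕ ℓ)))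
      ≡⟨ sum-cong-≗ (λ x → sum-cong-≗ (λ i → *-distribˡ-sum (δκ x i) (λ ℓ → δπ x ℓ * h i (toℕ ℓ)))) ⟩
    ∑[ x < n ] ∑[ i < K ] ∑[ ℓ < s i ] (δκ x i * (δπ x ℓ * h i (toℕ ℓ)))
      ≡⟨ ∑-comm {n} {K} (λ x i → ∑[ ℓ < s i ] (δκ x i * (δπ x ℓ * h i (toℕ ℓ)))) ⟩
    ∑[ i < K ] ∑[ x < n ] ∑[ ℓ < s i ] (δκ x i * (δπ x ℓ * h i (toℕ ℓ)))
      ≡⟨ sum-cong-≗ (λ i → ∑-comm {n} {s i} (λ x ℓ → δκ x i * (δπ x ℓ * h i (toℕ ℓ)))) ⟩
    ∑[ i < K ] ∑[ ℓ < s i ] ∑[ x < n ] (δκ x i * (δπ x ℓ * h i (toℕ ℓ)))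
      ≡⟨ sum-cong-≗ (λ i → sum-cong-≗ (λ ℓ → pull-out i ℓ)) ⟩
    ∑[ i < K ] ∑[ ℓ < s i ] (h i (toℕ ℓ) * fibreSize i ℓ) ∎
    where
    open ≡-Reasoning
    δκ : Fin n → Fin K → ℕ
    δκ x i = 𝟙 (does (κ x ≟ i))
    δπ : ∀ {i} → Fin n → Fin (s i) → ℕ
    δπ x ℓ = 𝟙 (π x ≡ᵇ toℕ ℓ)
    pull-out : ∀ i ℓ → ∑[ x < n ] (δκ x i * (δπ x ℓ * h i (toℕ ℓ))) ≡ h i (toℕ ℓ) * fibreSize i ℓ
    pull-out i ℓ = trans (sum-cong-≗ regroup) (sym (*-distribˡ-sum (h i (toℕ ℓ)) inFibre))
      where
      inFibre : Fin n → ℕ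
      inFibre x = 𝟙 (does (κ x ≟ i) ∧ (π x ≡ᵇ toℕ ℓ))
      regroup : ∀ x → δκ x i * (δπ x ℓ * h i (toℕ ℓ)) ≡ h i (toℕ ℓ) * inFibre x
      regroup x = begin
        δκ x i * (δπ x ℓ * h i (toℕ ℓ))  ≡⟨ *-assoc (δκ x i) (δπ x ℓ) _ ⟨
        δκ x i * δπ x ℓ * h i (toℕ ℓ)    ≡⟨ *-comm _ (h i (toℕ ℓ)) ⟩
        h i (toℕ ℓ) * (δκ x i * δπ x ℓ)  ≡⟨ cong (h i (toℕ ℓ) *_) (𝟙-∧ (does (κ x ≟ i)) _) ⟨
        h i (toℕ ℓ) * inFibre x          ∎

  fibreSize≤1 : ∀ i ℓ → fibreSize i ℓ ≤ 1
  fibreSize≤1 i ℓ = ∑-𝟙-≤1 _ λ x y x∈ y∈ →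
    let (κx≡i , πx≡ℓ) = Equivalence.to T-∧ x∈; (κy≡i , πy≡ℓ) = Equivalence.to T-∧ y∈
    in κπ-injective x y (trans (T-does⇒ (κ x ≟ i) κx≡i) (sym (T-does⇒ (κ y ≟ i) κy≡i)))
                        (trans (≡ᵇ⇒≡ _ _ πx≡ℓ) (sym (≡ᵇ⇒≡ _ _ πy≡ℓ)))

  -- Fibres have at most one element and their sizes add up to n = Σ s i.
  fibreSize≡1 : ∀ i ℓ → fibreSize i ℓ ≡ 1
  fibreSize≡1 i = ∑-≤-≡⇒≡ (fibreSize≤1 i) (∑-≤-≡⇒≡ (∑-mono-≤ ∘ fibreSize≤1) total i)
    where
    open ≡-Reasoning
    total : ∑[ i < K ] ∑[ ℓ < s i ] fibreSize i ℓ ≡ ∑[ i < K ] ∑[ ℓ < s i ] 1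
    total = begin
      ∑[ i < K ] ∑[ ℓ < s i ] fibreSize i ℓ
        ≡⟨ sum-cong-≗ (λ i → sum-cong-≗ (λ ℓ → *-identityˡ (fibreSize i ℓ))) ⟨
      ∑[ i < K ] ∑[ ℓ < s i ] (1 * fibreSize i ℓ)
        ≡⟨ ∑-by-fibreSize (λ _ _ → 1) ⟨
      ∑[ x < n ] 1
        ≡⟨ trans (∑-const n 1) (*-identityʳ n) ⟩
      n
        ≡⟨ ∑s≡n ⟨
      ∑[ i < K ] s i
        ≡⟨ sum-cong-≗ (λ i → trans (∑-const (s i) 1) (*-identityʳ (s i))) ⟨
      ∑[ i < K ] ∑[ ℓ < s i ] 1 ∎

  ∑-relabel : (h : Fin K → ℕ → ℕ) →
    ∑[ x < n ] h (κ x) (π x) ≡ ∑[ i < K ] ∑[ ℓ < s i ] h i (toℕ ℓ)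
  ∑-relabel h = trans (∑-by-fibreSize h) (sum-cong-≗ (λ i → sum-cong-≗ (λ ℓ →
    trans (cong (h i (toℕ ℓ) *_) (fibreSize≡1 i ℓ)) (*-identityʳ _))))

  ∑∑-relabel : (F : Fin K → ℕ → Fin K → ℕ → ℕ) →
    ∑[ x < n ] ∑[ y < n ] F (κ x) (π x) (κ y) (π y)
      ≡ ∑[ i < K ] ∑[ j < K ] ∑[ ℓ < s i ] ∑[ m < s j ] F i (toℕ ℓ) j (toℕ m)
  ∑∑-relabel F = begin
    ∑[ x < n ] ∑[ y < n ] F (κ x) (π x) (κ y) (π y)
      ≡⟨ sum-cong-≗ (λ x → ∑-relabel (F (κ x) (π x))) ⟩
    ∑[ x < n ] ∑[ j < K ] ∑[ m < s j ] F (κ x) (π x) j (toℕ m)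
      ≡⟨ ∑-relabel (λ i ℓ → ∑[ j < K ] ∑[ m < s j ] F i ℓ j (toℕ m)) ⟩
    ∑[ i < K ] ∑[ ℓ < s i ] ∑[ j < K ] ∑[ m < s j ] F i (toℕ ℓ) j (toℕ m)
      ≡⟨ sum-cong-≗ (λ i → ∑-comm {s i} {K} (λ ℓ j → ∑[ m < s j ] F i (toℕ ℓ) j (toℕ m))) ⟩
    ∑[ i < K ] ∑[ j < K ] ∑[ ℓ < s i ] ∑[ m < s j ] F i (toℕ ℓ) j (toℕ m) ∎
    where open ≡-Reasoning

-- The blow-up colouring

¬red⇒bluePurple : ∀ {c} → ¬ c ≡ red → c ≡ blue ⊎ c ≡ purple
¬red⇒bluePurple {red}    c≢red = contradiction refl c≢red
¬red⇒bluePurple {blue}   _     = inj₁ refl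
¬red⇒bluePurple {purple} _     = inj₂ refl

bluePurple⇒¬red : ∀ {c} → c ≡ blue ⊎ c ≡ purple → ¬ c ≡ red
bluePurple⇒¬red (inj₁ refl) ()
bluePurple⇒¬red (inj₂ refl) ()

module BlowUpColouring {k n : ℕ} {G : Graph (suc k)} (b : BlowUp G n) where

  private
    K : ℕ
    K = suc k
    s : Fin K → ℕ
    s = size b

  -- colour b x y unfolds to classColour (cls b x) (pos b x) (cls b y) (pos b y).
  classColour : Fin K → ℕ → Fin K → ℕ → Colour
  classColour i ℓ j m = if adj G i j then (if ℓ ≡ᵇ m then red else purple) else blue

  open InjectiveLabelling s (cls b) (pos b) (pos< b) (injective b) (trans (sym (sumFin≡∑ K s)) (size-sum b))

  n/K≤size : ∀ i → n / K ≤ s i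
  n/K≤size i with equitable b i
  ... | inj₁ sᵢ≡n/K  = ≤-reflexive (sym sᵢ≡n/K)
  ... | inj₂ sᵢ≡⌈n/K⌉ = ≤-trans (n/K≤⌈n/K⌉ k n) (≤-reflexive (sym sᵢ≡⌈n/K⌉))

  size≤⌈n/K⌉ : ∀ i → s i ≤ ⌈ n / K ⌉
  size≤⌈n/K⌉ i with equitable b i
  ... | inj₁ sᵢ≡n/K  = ≤-trans (≤-reflexive sᵢ≡n/K) (n/K≤⌈n/K⌉ k n)
  ... | inj₂ sᵢ≡⌈n/K⌉ = ≤-reflexive sᵢ≡⌈n/K⌉

  K*size≤n+k : ∀ i → K * s i ≤ n + k
  K*size≤n+k i = ≤-trans (*-monoʳ-≤ K (size≤⌈n/K⌉ i)) (K*⌈n/K⌉≤n+k k n)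

  GEdge-irrefl : ∀ i → ¬ GEdge G i i
  GEdge-irrefl i aᵢᵢ with trans (sym (adj-irrefl G i)) aᵢᵢ
  ... | ()

  redPurple⇒GEdge : ∀ {x y} → RedPurpleE b x y → GEdge G (cls b x) (cls b y)
  redPurple⇒GEdge {x} {y} rp with adj G (cls b x) (cls b y)
  ... | true  = refl
  ... | false with rp
  ...   | inj₁ ()
  ...   | inj₂ ()

  GEdge⇒redPurple : ∀ {x y} → GEdge G (cls b x) (cls b y) → RedPurpleE b x y
  GEdge⇒redPurple {x} {y} a rewrite a with pos b x ≡ᵇ pos b y
  ... | true  = inj₁ refl
  ... | false = inj₂ refl

  GEdge⇒red : ∀ {x y} → GEdge G (cls b x) (cls b y) → pos b x ≡ pos b y → RedE b x y
  GEdge⇒red {x} {y} a πx≡πy rewrite a with pos b x ≡ᵇ pos b y in eq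
  ... | true  = refl
  ... | false = contradiction (subst T eq (≡⇒≡ᵇ _ _ πx≡πy)) λ ()

  colour-sym : ∀ x y → colour b x y ≡ colour b y x
  colour-sym x y rewrite adj-sym G (cls b x) (cls b y) | ≡ᵇ-sym (pos b x) (pos b y) = refl

  2*countPairs-colour : (c : Colour → Bool) (e : ℕ → ℕ → Bool) →
    (∀ i ℓ j m → c (classColour i ℓ j m) ≡ adj G i j ∧ e ℓ m) →
    2 * countPairs n (λ x y → c (colour b x y))
      ≡ arcSum (adj G) (λ i j → ∑[ ℓ < s i ] ∑[ m < s j ] 𝟙 (e (toℕ ℓ) (toℕ m)))
  2*countPairs-colour c e factor = begin
    2 * countPairs n (λ x y → c (colour b x y))
      ≡⟨ 2*countPairs (λ x y → c (colour b x y)) (λ x y → cong c (colour-sym x y)) c-diag ⟩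
    ∑[ x < n ] ∑[ y < n ] 𝟙 (c (colour b x y))
      ≡⟨ ∑∑-relabel (λ i ℓ j m → 𝟙 (c (classColour i ℓ j m))) ⟩
    ∑[ i < K ] ∑[ j < K ] ∑[ ℓ < s i ] ∑[ m < s j ] 𝟙 (c (classColour i (toℕ ℓ) j (toℕ m)))
      ≡⟨ sum-cong-≗ (λ i → sum-cong-≗ (λ j → factored i j)) ⟩
    arcSum (adj G) (λ i j → ∑[ ℓ < s i ] ∑[ m < s j ] 𝟙 (e (toℕ ℓ) (toℕ m))) ∎
    where
    open ≡-Reasoning
    c-diag : ∀ x → c (colour b x x) ≡ false
    c-diag x = trans (factor _ _ _ _) (cong (_∧ e (pos b x) (pos b x)) (adj-irrefl G (cls b x)))
    factored : ∀ i j → ∑[ ℓ < s i ] ∑[ m < s j ] 𝟙 (c (classColour i (toℕ ℓ) j (toℕ m)))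
                       ≡ 𝟙 (adj G i j) * ∑[ ℓ < s i ] ∑[ m < s j ] 𝟙 (e (toℕ ℓ) (toℕ m))
    factored i j = begin
      ∑[ ℓ < s i ] ∑[ m < s j ] 𝟙 (c (classColour i (toℕ ℓ) j (toℕ m)))
        ≡⟨ sum-cong-≗ {s i} (λ ℓ → sum-cong-≗ {s j} (λ m → split (toℕ ℓ) (toℕ m))) ⟩
      ∑[ ℓ < s i ] ∑[ m < s j ] (𝟙 (adj G i j) * 𝟙 (e (toℕ ℓ) (toℕ m)))
        ≡⟨ sum-cong-≗ {s i} (λ ℓ → *-distribˡ-sum (𝟙 (adj G i j)) (λ (m : Fin (s j)) → 𝟙 (e (toℕ ℓ) (toℕ m)))) ⟨
      ∑[ ℓ < s i ] (𝟙 (adj G i j) * ∑[ m < s j ] 𝟙 (e (toℕ ℓ) (toℕ m)))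
        ≡⟨ *-distribˡ-sum (𝟙 (adj G i j)) (λ (ℓ : Fin (s i)) → ∑[ m < s j ] 𝟙 (e (toℕ ℓ) (toℕ m))) ⟨
      𝟙 (adj G i j) * ∑[ ℓ < s i ] ∑[ m < s j ] 𝟙 (e (toℕ ℓ) (toℕ m)) ∎
      where
      split : ∀ ℓ m → 𝟙 (c (classColour i ℓ j m)) ≡ 𝟙 (adj G i j) * 𝟙 (e ℓ m)
      split ℓ m = trans (cong 𝟙 (factor i ℓ j m)) (𝟙-∧ (adj G i j) (e ℓ m))

  redBetween purpleBetween : Fin K → Fin K → ℕ
  redBetween    i j = diagonal (s i) (s j)
  purpleBetween i j = offDiagonal (s i) (s j)

  2*numRed : 2 * numRed b ≡ arcSum (adj G) redBetween
  2*numRed = 2*countPairs-colour isRed (λ ℓ m → ℓ ≡ᵇ m) factor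
    where
    factor : ∀ i ℓ j m → isRed (classColour i ℓ j m) ≡ adj G i j ∧ (ℓ ≡ᵇ m)
    factor i ℓ j m with adj G i j | ℓ ≡ᵇ m
    ... | true  | true  = refl
    ... | true  | false = refl
    ... | false | _     = refl

  2*numPurple : 2 * numPurple b ≡ arcSum (adj G) purpleBetween
  2*numPurple = 2*countPairs-colour isPurple (λ ℓ m → not (ℓ ≡ᵇ m)) factor
    where
    factor : ∀ i ℓ j m → isPurple (classColour i ℓ j m) ≡ adj G i j ∧ not (ℓ ≡ᵇ m)
    factor i ℓ j m with adj G i j | ℓ ≡ᵇ m
    ... | true  | true  = refl
    ... | true  | false = refl
    ... | false | _     = refl

  2*edges : 2 * edges G ≡ arcs (adj G)
  2*edges = trans (2*countPairs (adj G) (adj-sym G) (adj-irrefl G))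
                  (sum-cong-≗ (λ i → sum-cong-≗ (λ j → sym (*-identityʳ (𝟙 (adj G i j))))))

  numPurple-≤ : k ≤ n → K * K * numPurple b ≤ edges G * (n * n) + 3 * edges G * n * K
  numPurple-≤ k≤n = begin
    K * K * numPurple b
      ≤⟨ averaged-≤ (adj G) purpleBetween 2*numPurple 2*edges (K * K) perEdge ⟩
    (n * n + 3 * n * K) * edges G
      ≡⟨ rearrange n K (edges G) ⟩
    edges G * (n * n) + 3 * edges G * n * K ∎
    where
    open ≤-Reasoning
    perEdge : ∀ i j → T (adj G i j) → K * K * purpleBetween i j ≤ n * n + 3 * n * K
    perEdge i j _ = pairBound-upper k≤n (K*size≤n+k i) (K*size≤n+k j) (offDiagonal≤ (s i) (s j))
    rearrange : ∀ n K E → (n * n + 3 * n * K) * E ≡ E * (n * n) + 3 * E * n * K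
    rearrange = solve-∀

  numPurple-≥ : K ≤ n → edges G * (n * n) ≤ K * K * numPurple b + 3 * edges G * n * K
  numPurple-≥ K≤n = begin
    edges G * (n * n)
      ≡⟨ *-comm (edges G) (n * n) ⟩
    n * n * edges G
      ≤⟨ averaged-≥ (adj G) purpleBetween 2*numPurple 2*edges (K * K) perEdge ⟩
    K * K * numPurple b + 3 * n * K * edges G
      ≡⟨ cong (K * K * numPurple b +_) (rearrange n K (edges G)) ⟩
    K * K * numPurple b + 3 * edges G * n * K ∎
    where
    open ≤-Reasoning
    perEdge : ∀ i j → T (adj G i j) → n * n ≤ K * K * purpleBetween i j + 3 * n * K
    perEdge i j _ = pairBound-lower (K≤n⇒1≤n/K k n K≤n) (K*[n/K]≤n k n) (n≤k+K*[n/K] k n)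
                                    (f*pred[f]≤offDiagonal (n/K≤size i) (n/K≤size j))
    rearrange : ∀ n K E → 3 * n * K * E ≡ 3 * E * n * K
    rearrange = solve-∀

  numRed-≤ : K * numRed b ≤ edges G * (n + K)
  numRed-≤ = begin
    K * numRed b           ≤⟨ averaged-≤ (adj G) redBetween 2*numRed 2*edges K perEdge ⟩
    (n + K) * edges G      ≡⟨ *-comm (n + K) (edges G) ⟩
    edges G * (n + K)      ∎
    where
    open ≤-Reasoning
    perEdge : ∀ i j → T (adj G i j) → K * redBetween i j ≤ n + K
    perEdge i j _ = begin
      K * redBetween i j       ≤⟨ *-monoʳ-≤ K (diagonal≤ (s i) (s j)) ⟩
      K * s i                  ≤⟨ K*size≤n+k i ⟩
      n + k                    ≤⟨ +-monoʳ-≤ n (n≤1+n k) ⟩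
      n + K                    ∎

  liftClique : Subset K → Subset n
  liftClique T = Vec.tabulate (λ x → (0 ≡ᵇ pos b x) ∧ lookup T (cls b x))

  ∈-liftClique⁻ : ∀ {T x} → x ∈ liftClique T → pos b x ≡ 0 × cls b x ∈ T
  ∈-liftClique⁻ {T} {x} x∈ with Equivalence.to T-∧ (∈-tabulate⁻ x∈)
  ... | pos≡0 , cls∈T = sym (≡ᵇ⇒≡ 0 (pos b x) pos≡0) , T⇒∈ cls∈T

  ∣liftClique∣ : K ≤ n → ∀ T → ∣ liftClique T ∣ ≡ ∣ T ∣
  ∣liftClique∣ K≤n T = begin
    ∣ liftClique T ∣
      ≡⟨ ∣tabulate∣ (λ x → (0 ≡ᵇ pos b x) ∧ lookup T (cls b x)) ⟩
    ∑[ x < n ] 𝟙 ((0 ≡ᵇ pos b x) ∧ lookup T (cls b x))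
      ≡⟨ ∑-relabel (λ i ℓ → 𝟙 ((0 ≡ᵇ ℓ) ∧ lookup T i)) ⟩
    ∑[ i < K ] ∑[ ℓ < s i ] 𝟙 ((0 ≡ᵇ toℕ ℓ) ∧ lookup T i)
      ≡⟨ sum-cong-≗ firstRow ⟩
    ∑[ i < K ] 𝟙 (lookup T i)
      ≡⟨ ∣p∣≡∑ T ⟨
    ∣ T ∣ ∎
    where
    open ≡-Reasoning
    firstRow : ∀ i → ∑[ ℓ < s i ] 𝟙 ((0 ≡ᵇ toℕ ℓ) ∧ lookup T i) ≡ 𝟙 (lookup T i)
    firstRow i = trans (sum-cong-≗ {s i} (λ ℓ → 𝟙-∧ (0 ≡ᵇ toℕ ℓ) (lookup T i)))
                       (∑-selectℕ 0<sᵢ (λ _ → 𝟙 (lookup T i)))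
      where
      0<sᵢ : 0 < s i
      0<sᵢ = ≤-trans (K≤n⇒1≤n/K k n K≤n) (n/K≤size i)

  liftClique-isClique : ∀ {T} → IsClique (GEdge G) T → IsClique (RedPurpleE b) (liftClique T)
  liftClique-isClique clq x y x∈ y∈ x≢y with ∈-liftClique⁻ x∈ | ∈-liftClique⁻ y∈
  ... | πx≡0 , κx∈T | πy≡0 , κy∈T = GEdge⇒redPurple (clq _ _ κx∈T κy∈T (λ κx≡κy →
          x≢y (injective b x y κx≡κy (trans πx≡0 (sym πy≡0)))))

  cliqueNumber-redPurple : K ≤ n → ∀ w → IsCliqueNumber (GEdge G) w → IsCliqueNumber (RedPurpleE b) w
  cliqueNumber-redPurple K≤n w ((T , T-clique , ∣T∣≡w) , maximal) =
    (liftClique T , liftClique-isClique T-clique , trans (∣liftClique∣ K≤n T) ∣T∣≡w) ,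
    homomorphism⇒clique≤ (cls b) redPurple⇒GEdge GEdge-irrefl maximal

  index : Fin n → Fin ⌈ n / K ⌉
  index x = fromℕ< (≤-trans (pos< b x) (size≤⌈n/K⌉ (cls b x)))

  index⇒pos : ∀ {x y} → index x ≡ index y → pos b x ≡ pos b y
  index⇒pos eq = trans (sym (toℕ-fromℕ< _)) (trans (cong toℕ eq) (toℕ-fromℕ< _))

  independent≤ : ∀ {S g} → IsIndependent (RedE b) S →
    (∀ T → IsIndependent (GEdge G) T → ∣ T ∣ ≤ g) → ∣ S ∣ ≤ ⌈ n / K ⌉ * g
  independent≤ {S} {g} S-indep maximal = begin
    ∣ S ∣                                    ≡⟨ ∣p∣≡∑∣fibre∣ index S ⟩
    ∑[ ℓ < ⌈ n / K ⌉ ] ∣ fibre index S ℓ ∣   ≤⟨ ∑-mono-≤ fibre≤ ⟩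
    ∑[ ℓ < ⌈ n / K ⌉ ] g                     ≡⟨ ∑-const ⌈ n / K ⌉ g ⟩
    ⌈ n / K ⌉ * g                            ∎
    where
    open ≤-Reasoning
    fibre≤ : ∀ ℓ → ∣ fibre index S ℓ ∣ ≤ g
    fibre≤ ℓ = reflecting⇒independent≤ (cls b) cls-injective reflects fibre-indep maximal
      where
      Sℓ : Subset n
      Sℓ = fibre index S ℓ
      ∈Sℓ⁻ : ∀ {x} → x ∈ Sℓ → index x ≡ ℓ × x ∈ S
      ∈Sℓ⁻ = ∈-fibre⁻ index
      samePos : ∀ {x y} → x ∈ Sℓ → y ∈ Sℓ → pos b x ≡ pos b y
      samePos x∈ y∈ = index⇒pos (trans (proj₁ (∈Sℓ⁻ x∈)) (sym (proj₁ (∈Sℓ⁻ y∈))))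
      cls-injective : InjectiveOn (cls b) Sℓ
      cls-injective x∈ y∈ κx≡κy = injective b _ _ κx≡κy (samePos x∈ y∈)
      reflects : ∀ {x y} → x ∈ Sℓ → y ∈ Sℓ → GEdge G (cls b x) (cls b y) → RedE b x y
      reflects x∈ y∈ a = GEdge⇒red a (samePos x∈ y∈)
      fibre-indep : IsIndependent (RedE b) Sℓ
      fibre-indep x y x∈ y∈ = S-indep x y (proj₂ (∈Sℓ⁻ x∈)) (proj₂ (∈Sℓ⁻ y∈))

  independenceNumber-red : ∀ a c g → IsIndepNumber (RedE b) a → IsCliqueNumber (BluePurpleE b) c →
    IsIndepNumber (GEdge G) g → a ≡ c × a ≤ ⌈ n / K ⌉ * g
  independenceNumber-red a c g α@((S , S-indep , ∣S∣≡a) , _) ω (_ , maximal) =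
    indepNumber≡cliqueNumber ¬red⇒bluePurple bluePurple⇒¬red α ω ,
    subst (_≤ _) ∣S∣≡a (independent≤ S-indep maximal)

proposition2p2 : (k : ℕ) → (G : Graph (suc k)) → (n : ℕ) → suc k ≤ n →
    (b : BlowUp G n) →
    -- (1) ω(R ∪ P) = ω(G)
    (∀ w → IsCliqueNumber (GEdge G) w → IsCliqueNumber (RedPurpleE b) w)
    -- (2) α(R) = ω(B ∪ P) ≤ ⌈n/k⌉ α(G)
    × (∀ a c g → IsIndepNumber (RedE b) a → IsCliqueNumber (BluePurpleE b) c →
         IsIndepNumber (GEdge G) g → a ≡ c × a ≤ ⌈ n / suc k ⌉ * g)
    -- (3) | |P| - e(G) n²/k² | ≤ e(G) 3n/k, multiplied through by k²
    × (suc k * suc k * numPurple b ≤ edges G * (n * n) + 3 * edges G * n * suc k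
       × edges G * (n * n) ≤ suc k * suc k * numPurple b + 3 * edges G * n * suc k)
    -- (4) |R| ≤ e(G) (n/k + 1), multiplied through by k
    × suc k * numRed b ≤ edges G * (n + suc k)
proposition2p2 k G n K≤n b =
    cliqueNumber-redPurple K≤n
  , independenceNumber-red
  , (numPurple-≤ (<⇒≤ K≤n) , numPurple-≥ K≤n)
  , numRed-≤
  where open BlowUpColouring b
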